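{- Let $\mathsf{L}$ be a superintuitionistic logic and let $\mathsf{L}^+ = \mathsf{Log}(\mathsf{Fin}(\mathsf{L}))$ and $\mathsf{L}^- = \mathsf{IPC} + \{\mathcal{J}(X) : X \text{ a finite rooted poset}, X \notin \mathsf{Fin}(\mathsf{L})\}$. Then: (1) the set of si-logics $\mathsf{L}'$ with $\mathsf{Fin}(\mathsf{L}')=\mathsf{Fin}(\mathsf{L})$ is exactly the interval $[\mathsf{L}^-, \mathsf{L}^+]$ of the lattice of si-logics (ordered by inclusion); (2) $\mathsf{L}^+$ is the only si-logic $\mathsf{L}'$ with $\mathsf{Fin}(\mathsf{L}')=\mathsf{Fin}(\mathsf{L})$ that has the finite model property; (3) $\mathsf{L}^-$ is the only si-logic $\mathsf{L}'$ with $\mathsf{Fin}(\mathsf{L}')=\mathsf{Fin}(\mathsf{L})$ that is axiomatizable (over $\mathsf{IPC}$) by Jankov formulas.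
   Context: A superintuitionistic logic (si-logic) is a set of intuitionistic formulas containing $\mathsf{IPC}$ and closed under modus ponens and substitution; $\mathsf{IPC}+\Sigma$ denotes the least si-logic containing $\Sigma$. Formulas are interpreted in posets with upset valuations (intuitionistic Kripke semantics). $\mathsf{Fin}(\mathsf{L})$ is the class of finite posets validating $\mathsf{L}$; for a class $K$ of posets, $\mathsf{Log}(K)$ is the set of formulas valid in every member of $K$. $\mathsf{L}$ has the finite model property (fmp) if $\mathsf{L} = \mathsf{Log}(\mathsf{Fin}(\mathsf{L}))$. A poset is rooted if it has a least element. For a finite rooted poset $X$, with $\mathsf{Up}(X)$ the Heyting algebra of upsets of $X$, the Jankov formula $\mathcal{J}(X)$ is a formula such that for every Heyting algebra $\mathbf{B}$, $\mathbf{B}$ refutes $\mathcal{J}(X)$ iff $\mathsf{Up}(X)$ is (isomorphic to) a subalgebra of a homomorphic image of $\mathbf{B}$. An si-logic is axiomatizable by Jankov formulas if it equals $\mathsf{IPC}+\Sigma$ for some set $\Sigma$ of Jankov formulas. -}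

module Defs where

open import Level using (0ℓ)
open import Data.Nat using (ℕ; zero; suc; _+_; _*_)
open import Data.Bool using (Bool; true; false; _∧_; _∨_; not; if_then_else_)
open import Data.Fin using (Fin; _≟_)
open import Data.Vec using (Vec; []; _∷_; lookup; tabulate; toList)
open import Data.List using (List; []; _∷_; foldr; filterᵇ; concatMap; map)
open import Data.Product using (Σ; ∃; _×_; _,_)
open import Relation.Binary.PropositionalEquality using (_≡_)
open import Relation.Nullary using (¬_; does)
open import Data.Empty using (⊥)
open import Data.Unit using (⊤)
open import Data.Sum using (_⊎_)

infixr 6 _∧'_
infixr 5 _∨'_
infixr 4 _⇒_ _⇔_

data Formula : Set where
  var  : ℕ → Formula
  ⊥'   : Formula
  _∧'_ : Formula → Formula → Formula
  _∨'_ : Formula → Formula → Formula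
  _⇒_  : Formula → Formula → Formula

⊤' : Formula
⊤' = ⊥' ⇒ ⊥'

_⇔_ : Formula → Formula → Formula
A ⇔ B = (A ⇒ B) ∧' (B ⇒ A)

subst : (ℕ → Formula) → Formula → Formula
subst σ (var p)  = σ p
subst σ ⊥'       = ⊥'
subst σ (A ∧' B) = subst σ A ∧' subst σ B
subst σ (A ∨' B) = subst σ A ∨' subst σ B
subst σ (A ⇒ B)  = subst σ A ⇒ subst σ B

FSet : Set₁
FSet = Formula → Set

_⊆_ : FSet → FSet → Set
L ⊆ L' = ∀ φ → L φ → L' φ

_≐_ : FSet → FSet → Set
L ≐ L' = (L ⊆ L') × (L' ⊆ L)

data IPCAxiom : Formula → Set where
  K   : ∀ A B → IPCAxiom (A ⇒ (B ⇒ A))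
  S   : ∀ A B C → IPCAxiom ((A ⇒ (B ⇒ C)) ⇒ ((A ⇒ B) ⇒ (A ⇒ C)))
  ∧E₁ : ∀ A B → IPCAxiom ((A ∧' B) ⇒ A)
  ∧E₂ : ∀ A B → IPCAxiom ((A ∧' B) ⇒ B)
  ∧I  : ∀ A B → IPCAxiom (A ⇒ (B ⇒ (A ∧' B)))
  ∨I₁ : ∀ A B → IPCAxiom (A ⇒ (A ∨' B))
  ∨I₂ : ∀ A B → IPCAxiom (B ⇒ (A ∨' B))
  ∨E  : ∀ A B C → IPCAxiom ((A ⇒ C) ⇒ ((B ⇒ C) ⇒ ((A ∨' B) ⇒ C)))
  efq : ∀ A → IPCAxiom (⊥' ⇒ A)

-- IPC + Σ : axioms, substitution instances of members of Σ, modus ponens.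
-- (This is the least si-logic containing Σ.)
data IPC+ (Σ' : FSet) : Formula → Set where
  ax  : ∀ {φ} → IPCAxiom φ → IPC+ Σ' φ
  hyp : ∀ {φ} (σ : ℕ → Formula) → Σ' φ → IPC+ Σ' (subst σ φ)
  mp  : ∀ {φ ψ} → IPC+ Σ' (φ ⇒ ψ) → IPC+ Σ' φ → IPC+ Σ' ψ

∅ : FSet
∅ _ = ⊥

IPC : FSet
IPC = IPC+ ∅

record IsSiLogic (L : FSet) : Set where
  field
    contains-IPC : IPC ⊆ L
    closed-mp    : ∀ φ ψ → L (φ ⇒ ψ) → L φ → L ψ
    closed-subst : ∀ (σ : ℕ → Formula) φ → L φ → L (subst σ φ)

record FinPoset : Set where
  field
    size  : ℕ
    _≼_   : Fin size → Fin size → Bool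
    refl  : ∀ x → (x ≼ x) ≡ true
    trans : ∀ x y z → (x ≼ y) ≡ true → (y ≼ z) ≡ true → (x ≼ z) ≡ true
    antisym : ∀ x y → (x ≼ y) ≡ true → (y ≼ x) ≡ true → x ≡ y

open FinPoset public

IsRoot : (P : FinPoset) → Fin (size P) → Set
IsRoot P r = ∀ x → _≼_ P r x ≡ true

Rooted : FinPoset → Set
Rooted P = Σ (Fin (size P)) (IsRoot P)

record Valuation (P : FinPoset) : Set where
  field
    val   : ℕ → Fin (size P) → Bool
    upset : ∀ p x y → _≼_ P x y ≡ true → val p x ≡ true → val p y ≡ true

open Valuation public

forces : (P : FinPoset) → Valuation P → Fin (size P) → Formula → Set
forces P V x (var p)  = val V p x ≡ true
forces P V x ⊥'       = ⊥
forces P V x (A ∧' B) = forces P V x A × forces P V x B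
forces P V x (A ∨' B) = forces P V x A ⊎ forces P V x B
forces P V x (A ⇒ B)  =
  ∀ y → _≼_ P x y ≡ true → forces P V y A → forces P V y B

_⊨_ : FinPoset → Formula → Set
P ⊨ φ = ∀ (V : Valuation P) (x : Fin (size P)) → forces P V x φ

_⊨ˢ_ : FinPoset → FSet → Set
P ⊨ˢ L = ∀ φ → L φ → P ⊨ φ

InFin : FSet → FinPoset → Set
InFin L P = P ⊨ˢ L

SameFin : FSet → FSet → Set
SameFin L L' = ∀ (P : FinPoset) → (InFin L P → InFin L' P) × (InFin L' P → InFin L P)

LogFin : FSet → FSet
LogFin L φ = ∀ (P : FinPoset) → InFin L P → P ⊨ φ

HasFMP : FSet → Set
HasFMP L = L ≐ LogFin L

-- Jankov formula of a finite rooted poset (standard algebraic version):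
-- one variable p_a per upset a of X, and
--   J(X) = (⋀ diagram of Up(X)) ⇒ p_s,
-- where s = X ∖ {root} is the second largest element (the opremum) of Up(X).

allSubsets : ∀ n → List (Vec Bool n)
allSubsets zero    = [] ∷ []
allSubsets (suc n) = concatMap (λ v → (true ∷ v) ∷ (false ∷ v) ∷ []) (allSubsets n)

allFinsL : ∀ n → List (Fin n)
allFinsL n = toList (tabulate (λ i → i))

allᵇ : ∀ {A : Set} → (A → Bool) → List A → Bool
allᵇ f = foldr (λ a b → f a ∧ b) true

_⇒ᵇ_ : Bool → Bool → Bool
a ⇒ᵇ b = not a ∨ b

isUpsetᵇ : (P : FinPoset) → Vec Bool (size P) → Bool
isUpsetᵇ P a = allᵇ (λ x → allᵇ (λ y → (_≼_ P x y ∧ lookup a x) ⇒ᵇ lookup a y)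
                                 (allFinsL (size P)))
                    (allFinsL (size P))

upsets : (P : FinPoset) → List (Vec Bool (size P))
upsets P = filterᵇ (isUpsetᵇ P) (allSubsets (size P))

meetU joinU impU : (P : FinPoset) → Vec Bool (size P) → Vec Bool (size P) → Vec Bool (size P)
meetU P a b = tabulate (λ x → lookup a x ∧ lookup b x)
joinU P a b = tabulate (λ x → lookup a x ∨ lookup b x)
impU  P a b = tabulate (λ x → allᵇ (λ y → _≼_ P x y ⇒ᵇ (lookup a y ⇒ᵇ lookup b y))
                                   (allFinsL (size P)))

emptyU : (P : FinPoset) → Vec Bool (size P)
emptyU P = tabulate (λ _ → false)

opremU : (P : FinPoset) → Fin (size P) → Vec Bool (size P)
opremU P r = tabulate (λ x → not (does (x ≟ r)))

-- injective coding of subsets as variable indices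
code : ∀ {n} → Vec Bool n → ℕ
code []          = 0
code (false ∷ v) = 2 * code v
code (true ∷ v)  = suc (2 * code v)

pv : ∀ {n} → Vec Bool n → Formula
pv a = var (code a)

⋀ : List Formula → Formula
⋀ = foldr _∧'_ ⊤'

diagram : (P : FinPoset) → Formula
diagram P =
  (pv (emptyU P) ⇔ ⊥') ∧'
  ⋀ (concatMap (λ a → map (λ b →
        (pv (meetU P a b) ⇔ (pv a ∧' pv b)) ∧'
        (pv (joinU P a b) ⇔ (pv a ∨' pv b)) ∧'
        (pv (impU P a b)  ⇔ (pv a ⇒ pv b)))
      (upsets P)) (upsets P))

Jankov : (P : FinPoset) → Fin (size P) → Formula
Jankov P r = diagram P ⇒ pv (opremU P r)

L⁺ : FSet → FSet
L⁺ L = LogFin L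

JankovNotIn : FSet → FSet
JankovNotIn L φ =
  Σ FinPoset λ X → Σ (Fin (size X)) λ r →
    IsRoot X r × ¬ InFin L X × (φ ≡ Jankov X r)

L⁻ : FSet → FSet
L⁻ L = IPC+ (JankovNotIn L)

JankovAxiomatizable : FSet → Set₁
JankovAxiomatizable L =
  Σ FSet λ Γ →
    (∀ φ → Γ φ → Σ FinPoset λ X → Σ (Fin (size X)) λ r → IsRoot X r × (φ ≡ Jankov X r))
    × (L ≐ IPC+ Γ)

-- Everything rests on Jankov's lemma: for an si-logic L and a finite rooted poset X,
-- X validates L iff J(X) ∉ L.  If φ ∈ L fails somewhere in X, substituting for each
-- variable p the atom naming the truth set of p turns φ into a formula that the
-- diagram of Up(X) proves equivalent to the atom of the truth set of φ; that set
-- misses the root, so the diagram together with this instance of φ proves the atom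
-- of X ∖ {root}, i.e. J(X) ∈ L.  Conversely X refutes J(X) at its root under the
-- valuation sending each atom to the upset it names.
-- Since a finite poset validates a formula iff all its rooted generated subframes do,
-- Fin(L') = Fin(L) holds iff L' contains J(X) for every rooted X ∉ Fin(L) and is valid
-- on Fin(L), i.e. L⁻ ⊆ L' ⊆ L⁺.  A logic has the fmp iff it equals Log Fin of itself,
-- which here is L⁺; and a Jankov axiomatization of such an L' can only use J(X) with
-- X ∉ Fin(L), because X refutes J(X), so L' ⊆ L⁻.
module Submission where

open import Defs hiding (refl; trans)
open import Level using (0ℓ)
open import Axiom.ExcludedMiddle using (ExcludedMiddle)
open import Function using (_∘_; id)
open import Function.Bundles using (mk⇔; module Equivalence) renaming (_⇔_ to _⟺_)
open import Data.Nat using (ℕ)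
open import Data.Nat.Properties using (even≢odd; *-cancelˡ-≡; suc-injective)
open import Data.Fin using (Fin; zero; suc; _≟_)
open import Data.Bool as Bool using (Bool; true; false; _∧_; _∨_; not; T?)
open import Data.Bool.Properties using (T-≡)
open import Data.Product using (∃; _×_; _,_; proj₁; proj₂)
open import Data.Sum as Sum using (_⊎_; inj₁; inj₂)
open import Relation.Nullary using (¬_; Dec; yes; no; does; contradiction)
open import Relation.Nullary.Decidable using (dec-true; decidable-stable)
open import Relation.Binary.PropositionalEquality as ≡
  using (_≡_; refl; sym; trans; cong; cong₂)
open import Data.Vec using (Vec; []; _∷_; lookup; tabulate)
open import Data.Vec.Properties using (lookup∘tabulate; tabulate∘lookup; tabulate-cong)
open import Data.Vec.Membership.Propositional.Properties using (∈-allFin⁺; ∈-toList⁺)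
open import Data.List as List using (List; []; _∷_; length; filter; allFin)
open import Data.List.Membership.Propositional using (_∈_; find)
open import Data.List.Membership.Propositional.Properties
  using (∈-filter⁺; ∈-filter⁻; ∈-lookup; ∈-allFin; ∈-concatMap⁺; ∈-concatMap⁻; ∈-map⁺; ∈-map⁻)
open import Data.List.Relation.Unary.Any as Any using (here; there; index)
open import Data.List.Relation.Unary.Any.Properties using (lookup-index)
import Data.List.Relation.Unary.All as All
open import Data.List.Relation.Unary.Unique.Propositional using (Unique; _∷_)
open import Data.List.Relation.Unary.Unique.Propositional.Properties using (allFin⁺; filter⁺)

open Equivalence using (to; from)

-- Kripke semantics

forces-mono : ∀ P V {x y} φ → _≼_ P x y ≡ true → forces P V x φ → forces P V y φ
forces-mono P V (var p)  x≼y h        = upset V p _ _ x≼y h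
forces-mono P V ⊥'       x≼y ()
forces-mono P V (A ∧' B) x≼y (a , b)  = forces-mono P V A x≼y a , forces-mono P V B x≼y b
forces-mono P V (A ∨' B) x≼y (inj₁ a) = inj₁ (forces-mono P V A x≼y a)
forces-mono P V (A ∨' B) x≼y (inj₂ b) = inj₂ (forces-mono P V B x≼y b)
forces-mono P V (A ⇒ B)  x≼y f        = λ z y≼z → f z (FinPoset.trans P _ _ z x≼y y≼z)

IPCAxiom-valid : ∀ P {φ} → IPCAxiom φ → P ⊨ φ
IPCAxiom-valid P (K A B) V x y _ a z y≼z _ = forces-mono P V A y≼z a
IPCAxiom-valid P (S A B C) V x y _ f z y≼z g w z≼w a =
  f w (FinPoset.trans P y z w y≼z z≼w) a w (FinPoset.refl P w) (g w z≼w a)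
IPCAxiom-valid P (∧E₁ A B) V x y _ = proj₁
IPCAxiom-valid P (∧E₂ A B) V x y _ = proj₂
IPCAxiom-valid P (∧I A B) V x y _ a z y≼z b = forces-mono P V A y≼z a , b
IPCAxiom-valid P (∨I₁ A B) V x y _ = inj₁
IPCAxiom-valid P (∨I₂ A B) V x y _ = inj₂
IPCAxiom-valid P (∨E A B C) V x y _ f z y≼z g w z≼w (inj₁ a) =
  f w (FinPoset.trans P y z w y≼z z≼w) a
IPCAxiom-valid P (∨E A B C) V x y _ f z y≼z g w z≼w (inj₂ b) = g w z≼w b
IPCAxiom-valid P (efq A) V x y _ ()

⊨-mp : ∀ P {φ ψ} → P ⊨ (φ ⇒ ψ) → P ⊨ φ → P ⊨ ψ
⊨-mp P f a V x = f V x x (FinPoset.refl P x) (a V x)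

IPC-sound : ∀ P {φ} → IPC φ → P ⊨ φ
IPC-sound P (ax a)   = IPCAxiom-valid P a
IPC-sound P (hyp σ ())
IPC-sound P (mp d e) = ⊨-mp P (IPC-sound P d) (IPC-sound P e)

Log : (FinPoset → Set) → FSet
Log 𝒦 φ = ∀ P → 𝒦 P → P ⊨ φ

dec-true⁻¹ : ∀ {A : Set} (a? : Dec A) → does a? ≡ true → A
dec-true⁻¹ (yes a) _ = a

module _ (em : ExcludedMiddle 0ℓ) where

  persistentValuation : (P : FinPoset) (F : ℕ → Fin (size P) → Set) →
    (∀ p {x y} → _≼_ P x y ≡ true → F p x → F p y) → Valuation P
  val   (persistentValuation P F F-mono) p x = does (em {F p x})
  upset (persistentValuation P F F-mono) p x y x≼y h =
    dec-true em (F-mono p x≼y (dec-true⁻¹ em h))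

  forces-persistentValuation : ∀ P F F-mono p x →
    forces P (persistentValuation P F F-mono) x (var p) ⟺ F p x
  forces-persistentValuation P F F-mono p x = mk⇔ (dec-true⁻¹ em) (dec-true em)

  module _ (P : FinPoset) (V : Valuation P) (σ : ℕ → Formula) where

    forces-σ : ℕ → Fin (size P) → Set
    forces-σ p x = forces P V x (σ p)

    forces-σ-mono : ∀ p {x y} → _≼_ P x y ≡ true → forces-σ p x → forces-σ p y
    forces-σ-mono p = forces-mono P V (σ p)

    substValuation : Valuation P
    substValuation = persistentValuation P forces-σ forces-σ-mono

    forces-subst : ∀ x φ → forces P substValuation x φ ⟺ forces P V x (subst σ φ)
    forces-subst x (var p) = forces-persistentValuation P forces-σ forces-σ-mono p x
    forces-subst x ⊥' = mk⇔ id id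
    forces-subst x (A ∧' B) = mk⇔
      (λ (a , b) → to (forces-subst x A) a , to (forces-subst x B) b)
      (λ (a , b) → from (forces-subst x A) a , from (forces-subst x B) b)
    forces-subst x (A ∨' B) = mk⇔
      (Sum.map (to (forces-subst x A)) (to (forces-subst x B)))
      (Sum.map (from (forces-subst x A)) (from (forces-subst x B)))
    forces-subst x (A ⇒ B) = mk⇔
      (λ f y x≼y a → to (forces-subst y B) (f y x≼y (from (forces-subst y A) a)))
      (λ f y x≼y a → from (forces-subst y B) (f y x≼y (to (forces-subst y A) a)))

  ⊨-subst : ∀ P σ {φ} → P ⊨ φ → P ⊨ subst σ φ
  ⊨-subst P σ {φ} h V x = to (forces-subst P V σ x φ) (h (substValuation P V σ) x)

  Log-isSiLogic : ∀ 𝒦 → IsSiLogic (Log 𝒦)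
  IsSiLogic.contains-IPC (Log-isSiLogic 𝒦) φ d P _    = IPC-sound P d
  IsSiLogic.closed-mp    (Log-isSiLogic 𝒦) φ ψ f a P k = ⊨-mp P (f P k) (a P k)
  IsSiLogic.closed-subst (Log-isSiLogic 𝒦) σ φ h P k   = ⊨-subst P σ (h P k)

-- The logics IPC + Γ

subst-∘ : ∀ σ τ φ → subst σ (subst τ φ) ≡ subst (subst σ ∘ τ) φ
subst-∘ σ τ (var p)  = refl
subst-∘ σ τ ⊥'       = refl
subst-∘ σ τ (A ∧' B) = cong₂ _∧'_ (subst-∘ σ τ A) (subst-∘ σ τ B)
subst-∘ σ τ (A ∨' B) = cong₂ _∨'_ (subst-∘ σ τ A) (subst-∘ σ τ B)
subst-∘ σ τ (A ⇒ B)  = cong₂ _⇒_ (subst-∘ σ τ A) (subst-∘ σ τ B)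

subst-var : ∀ φ → subst var φ ≡ φ
subst-var (var p)  = refl
subst-var ⊥'       = refl
subst-var (A ∧' B) = cong₂ _∧'_ (subst-var A) (subst-var B)
subst-var (A ∨' B) = cong₂ _∨'_ (subst-var A) (subst-var B)
subst-var (A ⇒ B)  = cong₂ _⇒_ (subst-var A) (subst-var B)

IPCAxiom-subst : ∀ σ {φ} → IPCAxiom φ → IPCAxiom (subst σ φ)
IPCAxiom-subst σ (K A B)    = K _ _
IPCAxiom-subst σ (S A B C)  = S _ _ _
IPCAxiom-subst σ (∧E₁ A B)  = ∧E₁ _ _
IPCAxiom-subst σ (∧E₂ A B)  = ∧E₂ _ _
IPCAxiom-subst σ (∧I A B)   = ∧I _ _
IPCAxiom-subst σ (∨I₁ A B)  = ∨I₁ _ _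
IPCAxiom-subst σ (∨I₂ A B)  = ∨I₂ _ _
IPCAxiom-subst σ (∨E A B C) = ∨E _ _ _
IPCAxiom-subst σ (efq A)    = efq _

IPC+-subst : ∀ Γ σ {φ} → IPC+ Γ φ → IPC+ Γ (subst σ φ)
IPC+-subst Γ σ (ax a)          = ax (IPCAxiom-subst σ a)
IPC+-subst Γ σ (hyp {φ} τ g)   = ≡.subst (IPC+ Γ) (sym (subst-∘ σ τ φ)) (hyp _ g)
IPC+-subst Γ σ (mp d e)        = mp (IPC+-subst Γ σ d) (IPC+-subst Γ σ e)

IPC+-mono : ∀ {Γ Δ} → Γ ⊆ Δ → IPC+ Γ ⊆ IPC+ Δ
IPC+-mono Γ⊆Δ _ (ax a)    = ax a
IPC+-mono Γ⊆Δ _ (hyp σ g) = hyp σ (Γ⊆Δ _ g)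
IPC+-mono Γ⊆Δ _ (mp d e)  = mp (IPC+-mono Γ⊆Δ _ d) (IPC+-mono Γ⊆Δ _ e)

⊆-IPC+ : ∀ Γ → Γ ⊆ IPC+ Γ
⊆-IPC+ Γ φ g = ≡.subst (IPC+ Γ) (subst-var φ) (hyp var g)

IPC+-isSiLogic : ∀ Γ → IsSiLogic (IPC+ Γ)
IsSiLogic.contains-IPC (IPC+-isSiLogic Γ) = IPC+-mono (λ _ ())
IsSiLogic.closed-mp    (IPC+-isSiLogic Γ) φ ψ = mp
IsSiLogic.closed-subst (IPC+-isSiLogic Γ) σ φ = IPC+-subst Γ σ

IPC+-least : ∀ {Γ L} → IsSiLogic L → Γ ⊆ L → IPC+ Γ ⊆ L
IPC+-least si Γ⊆L _ (ax a)    = IsSiLogic.contains-IPC si _ (ax a)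
IPC+-least si Γ⊆L _ (hyp σ g) = IsSiLogic.closed-subst si σ _ (Γ⊆L _ g)
IPC+-least si Γ⊆L _ (mp d e)  =
  IsSiLogic.closed-mp si _ _ (IPC+-least si Γ⊆L _ d) (IPC+-least si Γ⊆L _ e)

-- Derivations from hypotheses

infix 2 _⊢_

data _⊢_ (Γ : List Formula) : Formula → Set where
  axiom  : ∀ {φ} → IPCAxiom φ → Γ ⊢ φ
  assume : ∀ {φ} → φ ∈ Γ → Γ ⊢ φ
  mp⊢    : ∀ {φ ψ} → Γ ⊢ φ ⇒ ψ → Γ ⊢ φ → Γ ⊢ ψ

⊢-IPC : ∀ {φ} → [] ⊢ φ → IPC φ
⊢-IPC (axiom a)  = ax a
⊢-IPC (mp⊢ d e)  = mp (⊢-IPC d) (⊢-IPC e)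

assume₀ : ∀ {Γ A} → A ∷ Γ ⊢ A
assume₀ = assume (here refl)

⊢-weaken : ∀ {Γ A φ} → Γ ⊢ φ → A ∷ Γ ⊢ φ
⊢-weaken (axiom a)  = axiom a
⊢-weaken (assume m) = assume (there m)
⊢-weaken (mp⊢ d e)  = mp⊢ (⊢-weaken d) (⊢-weaken e)

module _ {Γ : List Formula} where

  ⊢-id : ∀ A → Γ ⊢ A ⇒ A
  ⊢-id A = mp⊢ (mp⊢ (axiom (S A (A ⇒ A) A)) (axiom (K A (A ⇒ A)))) (axiom (K A A))

  deduction : ∀ {A B} → A ∷ Γ ⊢ B → Γ ⊢ A ⇒ B
  deduction (axiom a)          = mp⊢ (axiom (K _ _)) (axiom a)
  deduction (assume (here refl)) = ⊢-id _
  deduction (assume (there m)) = mp⊢ (axiom (K _ _)) (assume m)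
  deduction (mp⊢ d e)          = mp⊢ (mp⊢ (axiom (S _ _ _)) (deduction d)) (deduction e)

  ∧-intro : ∀ {A B} → Γ ⊢ A → Γ ⊢ B → Γ ⊢ A ∧' B
  ∧-intro a b = mp⊢ (mp⊢ (axiom (∧I _ _)) a) b

  ∧-elimˡ : ∀ {A B} → Γ ⊢ A ∧' B → Γ ⊢ A
  ∧-elimˡ = mp⊢ (axiom (∧E₁ _ _))

  ∧-elimʳ : ∀ {A B} → Γ ⊢ A ∧' B → Γ ⊢ B
  ∧-elimʳ = mp⊢ (axiom (∧E₂ _ _))

  ∨-introˡ : ∀ {A B} → Γ ⊢ A → Γ ⊢ A ∨' B
  ∨-introˡ = mp⊢ (axiom (∨I₁ _ _))

  ∨-introʳ : ∀ {A B} → Γ ⊢ B → Γ ⊢ A ∨' B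
  ∨-introʳ = mp⊢ (axiom (∨I₂ _ _))

  ∨-elim : ∀ {A B C} → Γ ⊢ A ∨' B → A ∷ Γ ⊢ C → B ∷ Γ ⊢ C → Γ ⊢ C
  ∨-elim d e f = mp⊢ (mp⊢ (mp⊢ (axiom (∨E _ _ _)) (deduction e)) (deduction f)) d

  ⇔-intro : ∀ {A B} → A ∷ Γ ⊢ B → B ∷ Γ ⊢ A → Γ ⊢ A ⇔ B
  ⇔-intro d e = ∧-intro (deduction d) (deduction e)

  ⇔-elimˡ : ∀ {A B} → Γ ⊢ A ⇔ B → Γ ⊢ A → Γ ⊢ B
  ⇔-elimˡ d = mp⊢ (∧-elimˡ d)

  ⇔-elimʳ : ∀ {A B} → Γ ⊢ A ⇔ B → Γ ⊢ B → Γ ⊢ A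
  ⇔-elimʳ d = mp⊢ (∧-elimʳ d)

module _ {Γ : List Formula} where

  ⇔-refl : ∀ {A} → Γ ⊢ A ⇔ A
  ⇔-refl = ⇔-intro assume₀ assume₀

  ⇔-sym : ∀ {A B} → Γ ⊢ A ⇔ B → Γ ⊢ B ⇔ A
  ⇔-sym d = ∧-intro (∧-elimʳ d) (∧-elimˡ d)

  ⇔-trans : ∀ {A B C} → Γ ⊢ A ⇔ B → Γ ⊢ B ⇔ C → Γ ⊢ A ⇔ C
  ⇔-trans d e = ⇔-intro (⇔-elimˡ (⊢-weaken e) (⇔-elimˡ (⊢-weaken d) assume₀))
                        (⇔-elimʳ (⊢-weaken d) (⇔-elimʳ (⊢-weaken e) assume₀))

  ∧-cong : ∀ {A A′ B B′} → Γ ⊢ A ⇔ A′ → Γ ⊢ B ⇔ B′ → Γ ⊢ A ∧' B ⇔ A′ ∧' B′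
  ∧-cong d e = ⇔-intro
    (∧-intro (⇔-elimˡ (⊢-weaken d) (∧-elimˡ assume₀)) (⇔-elimˡ (⊢-weaken e) (∧-elimʳ assume₀)))
    (∧-intro (⇔-elimʳ (⊢-weaken d) (∧-elimˡ assume₀)) (⇔-elimʳ (⊢-weaken e) (∧-elimʳ assume₀)))

  ∨-cong : ∀ {A A′ B B′} → Γ ⊢ A ⇔ A′ → Γ ⊢ B ⇔ B′ → Γ ⊢ A ∨' B ⇔ A′ ∨' B′
  ∨-cong d e = ⇔-intro
    (∨-elim assume₀ (∨-introˡ (⇔-elimˡ (⊢-weaken (⊢-weaken d)) assume₀))
                    (∨-introʳ (⇔-elimˡ (⊢-weaken (⊢-weaken e)) assume₀)))
    (∨-elim assume₀ (∨-introˡ (⇔-elimʳ (⊢-weaken (⊢-weaken d)) assume₀))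
                    (∨-introʳ (⇔-elimʳ (⊢-weaken (⊢-weaken e)) assume₀)))

  ⇒-cong : ∀ {A A′ B B′} → Γ ⊢ A ⇔ A′ → Γ ⊢ B ⇔ B′ → Γ ⊢ (A ⇒ B) ⇔ (A′ ⇒ B′)
  ⇒-cong d e = ⇔-intro
    (deduction (⇔-elimˡ (⊢-weaken (⊢-weaken e))
                        (mp⊢ (⊢-weaken assume₀) (⇔-elimʳ (⊢-weaken (⊢-weaken d)) assume₀))))
    (deduction (⇔-elimʳ (⊢-weaken (⊢-weaken e))
                        (mp⊢ (⊢-weaken assume₀) (⇔-elimˡ (⊢-weaken (⊢-weaken d)) assume₀))))

-- The upset algebra Up(X) and its diagram

∧-true⁻ : ∀ {a b} → a ∧ b ≡ true → a ≡ true × b ≡ true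
∧-true⁻ {true} {true} _ = refl , refl

∧-true⁺ : ∀ {a b} → a ≡ true → b ≡ true → a ∧ b ≡ true
∧-true⁺ refl refl = refl

∨-true⁻ : ∀ {a b} → a ∨ b ≡ true → a ≡ true ⊎ b ≡ true
∨-true⁻ {true}          _ = inj₁ refl
∨-true⁻ {false} {true}  _ = inj₂ refl

∨-true⁺ : ∀ {a b} → a ≡ true ⊎ b ≡ true → a ∨ b ≡ true
∨-true⁺ {true}  _               = refl
∨-true⁺ {false} (inj₂ refl)     = refl

⇒ᵇ-true⁻ : ∀ {a b} → (a ⇒ᵇ b) ≡ true → a ≡ true → b ≡ true
⇒ᵇ-true⁻ {true} {true} _ _ = refl

⇒ᵇ-true⁺ : ∀ {a b} → (a ≡ true → b ≡ true) → (a ⇒ᵇ b) ≡ true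
⇒ᵇ-true⁺ {true}  f = f refl
⇒ᵇ-true⁺ {false} f = refl

≡true-ext : ∀ {a b} → (a ≡ true → b ≡ true) → (b ≡ true → a ≡ true) → a ≡ b
≡true-ext {true}  {true}  f g = refl
≡true-ext {true}  {false} f g = sym (f refl)
≡true-ext {false} {true}  f g = g refl
≡true-ext {false} {false} f g = refl

allᵇ-sound : ∀ {A : Set} (f : A → Bool) xs → allᵇ f xs ≡ true → ∀ {x} → x ∈ xs → f x ≡ true
allᵇ-sound f (y ∷ ys) h (here refl) = proj₁ (∧-true⁻ h)
allᵇ-sound f (y ∷ ys) h (there m)   = allᵇ-sound f ys (proj₂ (∧-true⁻ {f y} h)) m

allᵇ-complete : ∀ {A : Set} (f : A → Bool) xs → (∀ {x} → x ∈ xs → f x ≡ true) → allᵇ f xs ≡ true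
allᵇ-complete f []       g = refl
allᵇ-complete f (y ∷ ys) g = ∧-true⁺ (g (here refl)) (allᵇ-complete f ys (g ∘ there))

allᵇ-allFinsL : ∀ {n} (f : Fin n → Bool) → allᵇ f (allFinsL n) ≡ true ⟺ (∀ i → f i ≡ true)
allᵇ-allFinsL {n} f = mk⇔
  (λ h i → allᵇ-sound f (allFinsL n) h (∈-toList⁺ (∈-allFin⁺ i)))
  (λ g → allᵇ-complete f (allFinsL n) (λ {i} _ → g i))

IsUp : (P : FinPoset) → Vec Bool (size P) → Set
IsUp P a = ∀ x y → _≼_ P x y ≡ true → lookup a x ≡ true → lookup a y ≡ true

∈-allSubsets : ∀ {n} (v : Vec Bool n) → v ∈ allSubsets n
∈-allSubsets []      = here refl
∈-allSubsets (b ∷ v) =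
  ∈-concatMap⁺ (λ v → (true ∷ v) ∷ (false ∷ v) ∷ []) (Any.map (λ { refl → b∷v∈ b }) (∈-allSubsets v))
  where
  b∷v∈ : ∀ b → b ∷ v ∈ (true ∷ v) ∷ (false ∷ v) ∷ []
  b∷v∈ true  = here refl
  b∷v∈ false = there (here refl)

isUpsetᵇ-correct : ∀ P a → isUpsetᵇ P a ≡ true ⟺ IsUp P a
isUpsetᵇ-correct P a = mk⇔
  (λ h x y x≼y ax → ⇒ᵇ-true⁻ (to (allᵇ-allFinsL _) (to (allᵇ-allFinsL _) h x) y) (∧-true⁺ x≼y ax))
  (λ up → from (allᵇ-allFinsL _) λ x → from (allᵇ-allFinsL _) λ y →
     ⇒ᵇ-true⁺ λ h → up x y (proj₁ (∧-true⁻ h)) (proj₂ (∧-true⁻ h)))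

∈-upsets : ∀ P a → a ∈ upsets P ⟺ IsUp P a
∈-upsets P a = mk⇔
  (λ m → to (isUpsetᵇ-correct P a)
           (to T-≡ (proj₂ (∈-filter⁻ (T? ∘ isUpsetᵇ P) {xs = allSubsets (size P)} m))))
  (λ up → ∈-filter⁺ (T? ∘ isUpsetᵇ P) (∈-allSubsets a)
           (from T-≡ (from (isUpsetᵇ-correct P a) up)))

operationAxioms : (P : FinPoset) → Vec Bool (size P) → Vec Bool (size P) → Formula
operationAxioms P a b =
  (pv (meetU P a b) ⇔ (pv a ∧' pv b)) ∧'
  (pv (joinU P a b) ⇔ (pv a ∨' pv b)) ∧'
  (pv (impU P a b)  ⇔ (pv a ⇒ pv b))

operationAxiomList : FinPoset → List Formula
operationAxiomList P = List.concatMap (λ a → List.map (operationAxioms P a) (upsets P)) (upsets P)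

operationAxioms-∈ : ∀ P a b → IsUp P a → IsUp P b → operationAxioms P a b ∈ operationAxiomList P
operationAxioms-∈ P a b up-a up-b =
  ∈-concatMap⁺ (λ a → List.map (operationAxioms P a) (upsets P))
    (Any.map (λ { refl → ∈-map⁺ (operationAxioms P a) (from (∈-upsets P b) up-b) })
             (from (∈-upsets P a) up-a))

∈-operationAxiomList : ∀ P {ψ} → ψ ∈ operationAxiomList P →
  ∃ λ a → ∃ λ b → IsUp P a × IsUp P b × ψ ≡ operationAxioms P a b
∈-operationAxiomList P m
  with a , a∈ , m′ ← find (∈-concatMap⁻ (λ a → List.map (operationAxioms P a) (upsets P))
                                        {xs = upsets P} m)
  with b , b∈ , refl ← ∈-map⁻ (operationAxioms P a) m′
  = a , b , to (∈-upsets P a) a∈ , to (∈-upsets P b) b∈ , refl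

⋀-elim : ∀ {Γ ψ} xs → ψ ∈ xs → Γ ⊢ ⋀ xs → Γ ⊢ ψ
⋀-elim (x ∷ xs) (here refl) d = ∧-elimˡ d
⋀-elim (x ∷ xs) (there m)   d = ⋀-elim xs m (∧-elimʳ d)

forces-⋀ : ∀ P V y xs → (∀ {ψ} → ψ ∈ xs → forces P V y ψ) → forces P V y (⋀ xs)
forces-⋀ P V y []       _ = λ _ _ ()
forces-⋀ P V y (x ∷ xs) h = h (here refl) , forces-⋀ P V y xs (h ∘ there)

forces-diagram : ∀ P V y → forces P V y (pv (emptyU P) ⇔ ⊥') →
  (∀ a b → IsUp P a → IsUp P b → forces P V y (operationAxioms P a b)) →
  forces P V y (diagram P)
forces-diagram P V y h-empty h-ops = h-empty , forces-⋀ P V y (operationAxiomList P) λ m →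
  let a , b , up-a , up-b , ψ≡ = ∈-operationAxiomList P m
  in ≡.subst (forces P V y) (sym ψ≡) (h-ops a b up-a up-b)

module DiagramRules (P : FinPoset) {Γ : List Formula} (⊢diagram : Γ ⊢ diagram P) where

  ⊢empty : Γ ⊢ pv (emptyU P) ⇔ ⊥'
  ⊢empty = ∧-elimˡ ⊢diagram

  ⊢operationAxioms : ∀ a b → IsUp P a → IsUp P b → Γ ⊢ operationAxioms P a b
  ⊢operationAxioms a b up-a up-b =
    ⋀-elim (operationAxiomList P) (operationAxioms-∈ P a b up-a up-b) (∧-elimʳ ⊢diagram)

  ⊢meet : ∀ a b → IsUp P a → IsUp P b → Γ ⊢ pv (meetU P a b) ⇔ (pv a ∧' pv b)
  ⊢meet a b up-a up-b = ∧-elimˡ (⊢operationAxioms a b up-a up-b)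

  ⊢join : ∀ a b → IsUp P a → IsUp P b → Γ ⊢ pv (joinU P a b) ⇔ (pv a ∨' pv b)
  ⊢join a b up-a up-b = ∧-elimˡ (∧-elimʳ (⊢operationAxioms a b up-a up-b))

  ⊢imp : ∀ a b → IsUp P a → IsUp P b → Γ ⊢ pv (impU P a b) ⇔ (pv a ⇒ pv b)
  ⊢imp a b up-a up-b = ∧-elimʳ (∧-elimʳ (⊢operationAxioms a b up-a up-b))

module TruthSets (em : ExcludedMiddle 0ℓ) (X : FinPoset) (V : Valuation X) where

  ⟦_⟧ : Formula → Vec Bool (size X)
  ⟦ ψ ⟧ = tabulate (λ z → does (em {forces X V z ψ}))

  ∈⟦⟧ : ∀ ψ z → lookup ⟦ ψ ⟧ z ≡ true ⟺ forces X V z ψ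
  ∈⟦⟧ ψ z = mk⇔ (dec-true⁻¹ em ∘ trans (sym (lookup∘tabulate _ z)))
                (trans (lookup∘tabulate _ z) ∘ dec-true em)

  ⟦⟧-isUp : ∀ ψ → IsUp X ⟦ ψ ⟧
  ⟦⟧-isUp ψ x y x≼y h = from (∈⟦⟧ ψ y) (forces-mono X V ψ x≼y (to (∈⟦⟧ ψ x) h))

  ⟦⟧≡tabulate : ∀ ψ (f : Fin (size X) → Bool) →
    (∀ z → forces X V z ψ ⟺ (f z ≡ true)) → ⟦ ψ ⟧ ≡ tabulate f
  ⟦⟧≡tabulate ψ f h = tabulate-cong λ z →
    ≡true-ext (to (h z) ∘ dec-true⁻¹ em) (dec-true em ∘ from (h z))

  ⟦⊥⟧ : ⟦ ⊥' ⟧ ≡ emptyU X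
  ⟦⊥⟧ = ⟦⟧≡tabulate ⊥' _ λ _ → mk⇔ (λ ()) (λ ())

  ⟦∧⟧ : ∀ A B → ⟦ A ∧' B ⟧ ≡ meetU X ⟦ A ⟧ ⟦ B ⟧
  ⟦∧⟧ A B = ⟦⟧≡tabulate (A ∧' B) _ λ z → mk⇔
    (λ (a , b) → ∧-true⁺ (from (∈⟦⟧ A z) a) (from (∈⟦⟧ B z) b))
    (λ h → let a , b = ∧-true⁻ h in to (∈⟦⟧ A z) a , to (∈⟦⟧ B z) b)

  ⟦∨⟧ : ∀ A B → ⟦ A ∨' B ⟧ ≡ joinU X ⟦ A ⟧ ⟦ B ⟧
  ⟦∨⟧ A B = ⟦⟧≡tabulate (A ∨' B) _ λ z → mk⇔
    (∨-true⁺ ∘ Sum.map (from (∈⟦⟧ A z)) (from (∈⟦⟧ B z)))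
    (Sum.map (to (∈⟦⟧ A z)) (to (∈⟦⟧ B z)) ∘ ∨-true⁻)

  ⟦⇒⟧ : ∀ A B → ⟦ A ⇒ B ⟧ ≡ impU X ⟦ A ⟧ ⟦ B ⟧
  ⟦⇒⟧ A B = ⟦⟧≡tabulate (A ⇒ B) _ λ z → mk⇔
    (λ f → from (allᵇ-allFinsL _) λ y → ⇒ᵇ-true⁺ λ z≼y → ⇒ᵇ-true⁺ λ a →
       from (∈⟦⟧ B y) (f y z≼y (to (∈⟦⟧ A y) a)))
    (λ h y z≼y a → to (∈⟦⟧ B y)
       (⇒ᵇ-true⁻ (⇒ᵇ-true⁻ (to (allᵇ-allFinsL _) h y) z≼y) (from (∈⟦⟧ A y) a)))

  ⟦⟧≡⇒forces-⇔ : ∀ A B → ⟦ A ⟧ ≡ ⟦ B ⟧ → ∀ y → forces X V y (A ⇔ B)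
  ⟦⟧≡⇒forces-⇔ A B eq y =
      (λ z _ a → to (∈⟦⟧ B z) (≡.subst (λ v → lookup v z ≡ true) eq (from (∈⟦⟧ A z) a)))
    , (λ z _ b → to (∈⟦⟧ A z) (≡.subst (λ v → lookup v z ≡ true) (sym eq) (from (∈⟦⟧ B z) b)))

∈-opremU : ∀ X r z → lookup (opremU X r) z ≡ true ⟺ (¬ z ≡ r)
∈-opremU X r z rewrite lookup∘tabulate (λ y → not (does (y ≟ r))) z with z ≟ r
... | yes z≡r = mk⇔ (λ ()) (contradiction z≡r)
... | no  z≢r = mk⇔ (λ _ → z≢r) (λ _ → refl)

opremU-isUp : ∀ X {r} → IsRoot X r → IsUp X (opremU X r)
opremU-isUp X {r} root x y x≼y h = from (∈-opremU X r y) λ { refl →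
  to (∈-opremU X r x) h (FinPoset.antisym X x r x≼y (root x)) }

-- Jankov's lemma

code-injective : ∀ {n} (u v : Vec Bool n) → code u ≡ code v → u ≡ v
code-injective []          []          _  = refl
code-injective (false ∷ u) (false ∷ v) eq =
  cong (false ∷_) (code-injective u v (*-cancelˡ-≡ (code u) (code v) 2 eq))
code-injective (true ∷ u)  (true ∷ v)  eq =
  cong (true ∷_) (code-injective u v (*-cancelˡ-≡ (code u) (code v) 2 (suc-injective eq)))
code-injective (false ∷ u) (true ∷ v)  eq = contradiction eq (even≢odd (code u) (code v))
code-injective (true ∷ u)  (false ∷ v) eq = contradiction (sym eq) (even≢odd (code v) (code u))

module CanonicalValuation (em : ExcludedMiddle 0ℓ) (X : FinPoset) where

  NamesUpsetAt : ℕ → Fin (size X) → Set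
  NamesUpsetAt p y = ∃ λ a → IsUp X a × code a ≡ p × lookup a y ≡ true

  NamesUpsetAt-mono : ∀ p {x y} → _≼_ X x y ≡ true → NamesUpsetAt p x → NamesUpsetAt p y
  NamesUpsetAt-mono p x≼y (a , up , code≡ , a∋x) = a , up , code≡ , up _ _ x≼y a∋x

  canonical : Valuation X
  canonical = persistentValuation em X NamesUpsetAt NamesUpsetAt-mono

  forces-pv : ∀ a → IsUp X a → ∀ y → forces X canonical y (pv a) ⟺ (lookup a y ≡ true)
  forces-pv a up y = mk⇔
    (λ h → let b , _ , code≡ , b∋y = to forces-var h
           in ≡.subst (λ v → lookup v y ≡ true) (code-injective b a code≡) b∋y)
    (λ a∋y → from forces-var (a , up , refl , a∋y))
    where
    forces-var : forces X canonical y (pv a) ⟺ NamesUpsetAt (code a) y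
    forces-var = forces-persistentValuation em X NamesUpsetAt NamesUpsetAt-mono (code a) y

  open TruthSets em X canonical

  ⟦pv⟧ : ∀ a → IsUp X a → ⟦ pv a ⟧ ≡ a
  ⟦pv⟧ a up = trans (⟦⟧≡tabulate (pv a) (lookup a) (forces-pv a up)) (tabulate∘lookup a)

  pv-⇔ : ∀ a ψ → a ≡ ⟦ ψ ⟧ → ∀ y → forces X canonical y (pv a ⇔ ψ)
  pv-⇔ _ ψ refl = ⟦⟧≡⇒forces-⇔ (pv ⟦ ψ ⟧) ψ (⟦pv⟧ ⟦ ψ ⟧ (⟦⟧-isUp ψ))

  forces-diagram-canonical : ∀ y → forces X canonical y (diagram X)
  forces-diagram-canonical y = forces-diagram X canonical y (pv-⇔ _ ⊥' (sym ⟦⊥⟧) y)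
    λ a b up-a up-b →
      let ⟦a⟧ = sym (⟦pv⟧ a up-a) ; ⟦b⟧ = sym (⟦pv⟧ b up-b) in
        pv-⇔ _ _ (trans (cong₂ (meetU X) ⟦a⟧ ⟦b⟧) (sym (⟦∧⟧ (pv a) (pv b)))) y
      , pv-⇔ _ _ (trans (cong₂ (joinU X) ⟦a⟧ ⟦b⟧) (sym (⟦∨⟧ (pv a) (pv b)))) y
      , pv-⇔ _ _ (trans (cong₂ (impU X) ⟦a⟧ ⟦b⟧) (sym (⟦⇒⟧ (pv a) (pv b)))) y

Jankov-refuted : ExcludedMiddle 0ℓ → ∀ X {r} → IsRoot X r → ¬ X ⊨ Jankov X r
Jankov-refuted em X {r} root ⊨J = to (∈-opremU X r r) r∈X∖r refl
  where
  open CanonicalValuation em X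

  r∈X∖r : lookup (opremU X r) r ≡ true
  r∈X∖r = to (forces-pv (opremU X r) (opremU-isUp X root) r)
             (⊨J canonical r r (FinPoset.refl X r) (forces-diagram-canonical r))

module JankovSubstitution (em : ExcludedMiddle 0ℓ) (X : FinPoset) (V : Valuation X) where

  open TruthSets em X V

  σ : ℕ → Formula
  σ p = pv ⟦ var p ⟧

  module _ {Γ} (⊢Δ : Γ ⊢ diagram X) where
    open DiagramRules X ⊢Δ

    diagram-⊢-σ : ∀ ψ → Γ ⊢ subst σ ψ ⇔ pv ⟦ ψ ⟧
    diagram-⊢-σ (var p) = ⇔-refl
    diagram-⊢-σ ⊥' rewrite ⟦⊥⟧ = ⇔-sym ⊢empty
    diagram-⊢-σ (A ∧' B) rewrite ⟦∧⟧ A B = ⇔-trans (∧-cong (diagram-⊢-σ A) (diagram-⊢-σ B))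
      (⇔-sym (⊢meet ⟦ A ⟧ ⟦ B ⟧ (⟦⟧-isUp A) (⟦⟧-isUp B)))
    diagram-⊢-σ (A ∨' B) rewrite ⟦∨⟧ A B = ⇔-trans (∨-cong (diagram-⊢-σ A) (diagram-⊢-σ B))
      (⇔-sym (⊢join ⟦ A ⟧ ⟦ B ⟧ (⟦⟧-isUp A) (⟦⟧-isUp B)))
    diagram-⊢-σ (A ⇒ B) rewrite ⟦⇒⟧ A B = ⇔-trans (⇒-cong (diagram-⊢-σ A) (diagram-⊢-σ B))
      (⇔-sym (⊢imp ⟦ A ⟧ ⟦ B ⟧ (⟦⟧-isUp A) (⟦⟧-isUp B)))

  Jankov-∈ : ∀ {L r φ y} → IsSiLogic L → IsRoot X r → L φ → ¬ forces X V y φ → L (Jankov X r)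
  Jankov-∈ {L} {r} {φ} {y} si root φ∈L φ-fails =
    IsSiLogic.closed-mp si _ _ σφ⇒J (IsSiLogic.closed-subst si σ φ φ∈L)
    where
    s : Vec Bool (size X)
    s = opremU X r

    ⟦φ⟧⊆s : meetU X ⟦ φ ⟧ s ≡ ⟦ φ ⟧
    ⟦φ⟧⊆s = sym (⟦⟧≡tabulate φ _ λ z → mk⇔
      (λ z⊩φ → ∧-true⁺ (from (∈⟦⟧ φ z) z⊩φ)
                       (from (∈-opremU X r z) λ { refl → φ-fails (forces-mono X V φ (root y) z⊩φ) }))
      (λ h → to (∈⟦⟧ φ z) (proj₁ (∧-true⁻ h))))

    Γ : List Formula
    Γ = diagram X ∷ subst σ φ ∷ []

    open DiagramRules X {Γ} assume₀

    ⊢⟦φ⟧ : Γ ⊢ pv ⟦ φ ⟧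
    ⊢⟦φ⟧ = ⇔-elimˡ (diagram-⊢-σ assume₀ φ) (assume (there (here refl)))

    ⊢s : Γ ⊢ pv s
    ⊢s = ∧-elimʳ (⇔-elimˡ (⊢meet ⟦ φ ⟧ s (⟦⟧-isUp φ) (opremU-isUp X root))
                          (≡.subst (λ v → Γ ⊢ pv v) (sym ⟦φ⟧⊆s) ⊢⟦φ⟧))

    σφ⇒J : L (subst σ φ ⇒ Jankov X r)
    σφ⇒J = IsSiLogic.contains-IPC si _ (⊢-IPC (deduction (deduction ⊢s)))

Jankov-lemma : ExcludedMiddle 0ℓ → ∀ {L X r} → IsSiLogic L → IsRoot X r →
  InFin L X ⟺ (¬ L (Jankov X r))
Jankov-lemma em {X = X} si root = mk⇔
  (λ X∈Fin J∈L → Jankov-refuted em X root (X∈Fin _ J∈L))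
  (λ J∉L φ φ∈L V y → decidable-stable em λ φ-fails →
     J∉L (JankovSubstitution.Jankov-∈ em X V si root φ∈L φ-fails))

-- Generated subframes

lookup-injective : ∀ {A : Set} {xs : List A} → Unique xs →
  ∀ {i j} → List.lookup xs i ≡ List.lookup xs j → i ≡ j
lookup-injective {xs = _ ∷ _} (_ ∷ _)   {zero}  {zero}  _  = refl
lookup-injective {xs = _ ∷ _} (x≢ ∷ _)  {zero}  {suc j} eq =
  contradiction eq (All.lookup x≢ (∈-lookup j))
lookup-injective {xs = _ ∷ _} (x≢ ∷ _)  {suc i} {zero}  eq =
  contradiction (sym eq) (All.lookup x≢ (∈-lookup i))
lookup-injective {xs = _ ∷ _} (_ ∷ u)   {suc i} {suc j} eq = cong suc (lookup-injective u eq)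

module _ (P : FinPoset) (x : Fin (size P)) where

  private
    x≼? : ∀ y → Dec (_≼_ P x y ≡ true)
    x≼? y = _≼_ P x y Bool.≟ true

    above : List (Fin (size P))
    above = filter x≼? (allFin (size P))

  ι : Fin (length above) → Fin (size P)
  ι = List.lookup above

  ι-above : ∀ i → _≼_ P x (ι i) ≡ true
  ι-above i = proj₂ (∈-filter⁻ x≼? {xs = allFin (size P)} (∈-lookup i))

  ι-onto : ∀ {y} → _≼_ P x y ≡ true → ∃ λ i → ι i ≡ y
  ι-onto {y} x≼y = let y∈ = ∈-filter⁺ x≼? (∈-allFin y) x≼y in index y∈ , sym (lookup-index y∈)

  generatedSubframe : FinPoset
  size    generatedSubframe = length above
  _≼_     generatedSubframe i j = _≼_ P (ι i) (ι j)
  FinPoset.refl    generatedSubframe i = FinPoset.refl P (ι i)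
  FinPoset.trans   generatedSubframe i j k = FinPoset.trans P (ι i) (ι j) (ι k)
  FinPoset.antisym generatedSubframe i j i≼j j≼i =
    lookup-injective (filter⁺ x≼? (allFin⁺ (size P))) (FinPoset.antisym P (ι i) (ι j) i≼j j≼i)

  generatedRoot : Fin (size generatedSubframe)
  generatedRoot = proj₁ (ι-onto (FinPoset.refl P x))

  ι-generatedRoot : ι generatedRoot ≡ x
  ι-generatedRoot = proj₂ (ι-onto (FinPoset.refl P x))

  generatedRoot-isRoot : IsRoot generatedSubframe generatedRoot
  generatedRoot-isRoot j rewrite ι-generatedRoot = ι-above j

  module _ (U : Valuation generatedSubframe) (W : Valuation P)
           (U≗W∘ι : ∀ q i → val U q i ≡ val W q (ι i)) where

    forces-ι : ∀ i ψ → forces generatedSubframe U i ψ ⟺ forces P W (ι i) ψ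
    forces-ι i (var q) = mk⇔ (trans (sym (U≗W∘ι q i))) (trans (U≗W∘ι q i))
    forces-ι i ⊥' = mk⇔ id id
    forces-ι i (A ∧' B) = mk⇔
      (λ (a , b) → to (forces-ι i A) a , to (forces-ι i B) b)
      (λ (a , b) → from (forces-ι i A) a , from (forces-ι i B) b)
    forces-ι i (A ∨' B) = mk⇔
      (Sum.map (to (forces-ι i A)) (to (forces-ι i B)))
      (Sum.map (from (forces-ι i A)) (from (forces-ι i B)))
    forces-ι i (A ⇒ B) = mk⇔ to-⇒
      (λ f j i≼j a → from (forces-ι j B) (f (ι j) i≼j (to (forces-ι j A) a)))
      where
      -- every point above ι i lies in the image of ι, since x ≼ ι i
      to-⇒ : forces generatedSubframe U i (A ⇒ B) → forces P W (ι i) (A ⇒ B)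
      to-⇒ f z ιi≼z a with j , refl ← ι-onto (FinPoset.trans P x (ι i) z (ι-above i) ιi≼z) =
        to (forces-ι j B) (f j ιi≼z (from (forces-ι j A) a))

  restrict : Valuation P → Valuation generatedSubframe
  val   (restrict V) q i = val V q (ι i)
  upset (restrict V) q i j = upset V q (ι i) (ι j)

  refuted-generatedSubframe : ∀ {V φ} → ¬ forces P V x φ → ¬ generatedSubframe ⊨ φ
  refuted-generatedSubframe {V} {φ} φ-fails ⊨φ = φ-fails
    (≡.subst (λ y → forces P V y φ) ι-generatedRoot
      (to (forces-ι (restrict V) V (λ _ _ → refl) generatedRoot φ) (⊨φ (restrict V) generatedRoot)))

  module _ (em : ExcludedMiddle 0ℓ) (U : Valuation generatedSubframe) where

    ForcedBelow : ℕ → Fin (size P) → Set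
    ForcedBelow q y = ∃ λ i → _≼_ P (ι i) y ≡ true × val U q i ≡ true

    ForcedBelow-mono : ∀ q {y z} → _≼_ P y z ≡ true → ForcedBelow q y → ForcedBelow q z
    ForcedBelow-mono q y≼z (i , ιi≼y , Ui) = i , FinPoset.trans P (ι i) _ _ ιi≼y y≼z , Ui

    extend : Valuation P
    extend = persistentValuation em P ForcedBelow ForcedBelow-mono

    restrict-extend : ∀ q i → val U q i ≡ val extend q (ι i)
    restrict-extend q i = ≡true-ext
      (λ Ui → from forces-var (i , FinPoset.refl P (ι i) , Ui))
      (λ h → let j , j≼i , Uj = to forces-var h in upset U q j i j≼i Uj)
      where
      forces-var : forces P extend (ι i) (var q) ⟺ ForcedBelow q (ι i)
      forces-var = forces-persistentValuation em P ForcedBelow ForcedBelow-mono q (ι i)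

  ⊨-generatedSubframe : ExcludedMiddle 0ℓ → ∀ {φ} → P ⊨ φ → generatedSubframe ⊨ φ
  ⊨-generatedSubframe em {φ} ⊨φ U i =
    from (forces-ι U (extend em U) (restrict-extend em U) i φ) (⊨φ (extend em U) (ι i))

InFin-generatedSubframe : ExcludedMiddle 0ℓ → ∀ {L P} x →
  InFin L P → InFin L (generatedSubframe P x)
InFin-generatedSubframe em {P = P} x P∈Fin φ φ∈L = ⊨-generatedSubframe P x em (P∈Fin φ φ∈L)

InFin-from-generatedSubframes : ExcludedMiddle 0ℓ → ∀ {L P} →
  (∀ x → InFin L (generatedSubframe P x)) → InFin L P
InFin-from-generatedSubframes em {P = P} h φ φ∈L V x = decidable-stable em λ φ-fails →
  refuted-generatedSubframe P x φ-fails (h x φ φ∈L)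

-- Logics with the same finite frames

≐-sym : ∀ {L₁ L₂} → L₁ ≐ L₂ → L₂ ≐ L₁
≐-sym (⊆₁ , ⊆₂) = ⊆₂ , ⊆₁

≐-trans : ∀ {L₁ L₂ L₃} → L₁ ≐ L₂ → L₂ ≐ L₃ → L₁ ≐ L₃
≐-trans (⊆₁ , ⊇₁) (⊆₂ , ⊇₂) = (λ φ → ⊆₂ φ ∘ ⊆₁ φ) , (λ φ → ⊇₁ φ ∘ ⊇₂ φ)

LogFin-cong : ∀ {L L'} → SameFin L' L → LogFin L' ≐ LogFin L
LogFin-cong same = (λ φ h P P∈FinL  → h P (proj₂ (same P) P∈FinL))
                 , (λ φ h P P∈FinL' → h P (proj₁ (same P) P∈FinL'))

L⁺-sameFin : ∀ L → SameFin (L⁺ L) L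
L⁺-sameFin L P = (λ P∈FinL⁺ φ φ∈L → P∈FinL⁺ φ λ Q Q∈FinL → Q∈FinL φ φ∈L)
               , (λ P∈FinL φ φ∈L⁺ → φ∈L⁺ P P∈FinL)

L⁺-hasFMP : ∀ L → HasFMP (L⁺ L)
L⁺-hasFMP L = ≐-sym (LogFin-cong (L⁺-sameFin L))

hasFMP-unique : ∀ {L L'} → SameFin L' L → HasFMP L' → L' ≐ L⁺ L
hasFMP-unique same fmp = ≐-trans fmp (LogFin-cong same)

L⁻-JankovAxiomatizable : ∀ L → JankovAxiomatizable (L⁻ L)
L⁻-JankovAxiomatizable L =
  JankovNotIn L , (λ { _ (X , r , root , _ , φ≡) → X , r , root , φ≡ }) , (λ _ → id) , (λ _ → id)

module _ (em : ExcludedMiddle 0ℓ) (L : FSet) where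

  sameFin⇒interval : ∀ {L'} → IsSiLogic L' → SameFin L' L → L⁻ L ⊆ L' × L' ⊆ L⁺ L
  sameFin⇒interval {L'} si' same =
    IPC+-least si' Jankov∈L' , λ φ φ∈L' P P∈FinL → proj₂ (same P) P∈FinL φ φ∈L'
    where
    Jankov∈L' : JankovNotIn L ⊆ L'
    Jankov∈L' _ (X , r , root , X∉FinL , refl) = decidable-stable em λ J∉L' →
      X∉FinL (proj₁ (same X) (from (Jankov-lemma em si' root) J∉L'))

  interval⇒sameFin : ∀ {L'} → L⁻ L ⊆ L' × L' ⊆ L⁺ L → SameFin L' L
  interval⇒sameFin {L'} (L⁻⊆L' , L'⊆L⁺) P =
      (λ P∈FinL' → InFin-from-generatedSubframes em λ x →
         rooted (generatedRoot-isRoot P x) (InFin-generatedSubframe em x P∈FinL'))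
    , (λ P∈FinL φ φ∈L' → L'⊆L⁺ φ φ∈L' P P∈FinL)
    where
    rooted : ∀ {X r} → IsRoot X r → InFin L' X → InFin L X
    rooted {X} {r} root X∈FinL' = decidable-stable em λ X∉FinL →
      Jankov-refuted em X root (X∈FinL' _ (L⁻⊆L' _ (⊆-IPC+ _ _ (X , r , root , X∉FinL , refl))))

  L⁺-isSiLogic : IsSiLogic (L⁺ L)
  L⁺-isSiLogic = Log-isSiLogic em (InFin L)

  L⁻-sameFin : SameFin (L⁻ L) L
  L⁻-sameFin = interval⇒sameFin ((λ _ → id) , proj₁ (sameFin⇒interval L⁺-isSiLogic (L⁺-sameFin L)))

  JankovAxiomatizable-unique : ∀ {L'} → IsSiLogic L' → SameFin L' L →
    JankovAxiomatizable L' → L' ≐ L⁻ L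
  JankovAxiomatizable-unique si' same (Γ , Γ-Jankov , L'≐) =
    (λ φ φ∈L' → IPC+-mono Γ⊆ φ (proj₁ L'≐ φ φ∈L')) , proj₁ (sameFin⇒interval si' same)
    where
    Γ⊆ : Γ ⊆ JankovNotIn L
    Γ⊆ ψ ψ∈Γ with X , r , root , refl ← Γ-Jankov ψ ψ∈Γ = X , r , root , X∉FinL , refl
      where
      X∉FinL : ¬ InFin L X
      X∉FinL X∈FinL =
        to (Jankov-lemma em si' root) (proj₂ (same X) X∈FinL) (proj₂ L'≐ _ (⊆-IPC+ Γ _ ψ∈Γ))

theorem3p10 : ExcludedMiddle 0ℓ → (L : FSet) → IsSiLogic L →
    ((L' : FSet) → IsSiLogic L' →
      (SameFin L' L → (L⁻ L ⊆ L') × (L' ⊆ L⁺ L)) × ((L⁻ L ⊆ L') × (L' ⊆ L⁺ L) → SameFin L' L))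
    × ((IsSiLogic (L⁺ L) × SameFin (L⁺ L) L × HasFMP (L⁺ L))
       × ((L' : FSet) → IsSiLogic L' → SameFin L' L → HasFMP L' → L' ≐ L⁺ L))
    × ((IsSiLogic (L⁻ L) × SameFin (L⁻ L) L × JankovAxiomatizable (L⁻ L))
       × ((L' : FSet) → IsSiLogic L' → SameFin L' L → JankovAxiomatizable L' → L' ≐ L⁻ L))
-- The proof never uses that L itself is an si-logic.
theorem3p10 em L _ =
    (λ L' si' → sameFin⇒interval em L si' , interval⇒sameFin em L)
  , ((L⁺-isSiLogic em L , L⁺-sameFin L , L⁺-hasFMP L) , λ L' _ → hasFMP-unique)
  , ((IPC+-isSiLogic (JankovNotIn L) , L⁻-sameFin em L , L⁻-JankovAxiomatizable L)
    , λ L' → JankovAxiomatizable-unique em L)
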